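{- Let $A$ and $B$ be clauses in which the variable $x$ does not appear and let $w$ be the width of $A\lor B$. Then the inequality $M(A\lor x)+M(B\lor\bar x)-M(A\lor B)\ge0$ has a derivation in Sherali-Adams resolution (SAR) of rank $w+1$ and size $O(w^2)$.
   Context: Variables are $x_1,\dots,x_n$ and twins $\bar x_1,\dots,\bar x_n$, treated as independent real variables. For disjoint sets of variables $Y,Z$ let $M(Y,Z)=\prod_{y\in Y}\bar y\prod_{z\in Z}z$. For a clause $C=\bigvee_{y\in V^+}y\lor\bigvee_{z\in V^- }\bar z$ (with $V^+$, $V^-$ the variables occurring positively, resp. negatively), $M(C)=M(V^+,V^-)$. The width of a clause is its number of literals. An SAR derivation of $r\ge0$ (from a possibly empty set of premises $q_1\ge0,\dots,q_m\ge0$) is an expression $\sum_{t=1}^{\tau}\alpha_t\prod_{i\in I_t}x_i\prod_{j\in J_t}(1-x_j)\,p_t$, where the products range over variables from $\{x_1,\dots,x_n,\bar x_1,\dots,\bar x_n\}$, $\alpha_t\ge0$ are reals, and each $p_t$ is one of the $q_j$, an axiom $x^2-x$ or $x-x^2$ (for any such variable), a complementarity axiom $1-x_i-\bar x_i$ or $-1+x_i+\bar x_i$, or the constant $1$, and which expands to $r$. Its rank is the maximum degree of the polynomials to which the summands expand, and its size is the sum of their numbers of terms. -}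

module Defs where

open import Data.Nat as ℕ using (ℕ; zero; suc; _⊔_)
open import Data.Fin using (Fin)
open import Data.Fin.Subset using (Subset; _∪_; ⁅_⁆; ∣_∣)
open import Data.Vec as Vec using (Vec; replicate; zipWith; _[_]≔_)
open import Data.Vec.Properties as VecP using ()
open import Data.Bool using (Bool; true; false; if_then_else_)
open import Data.Product using (_×_; _,_; proj₁; proj₂)
open import Data.Product.Properties as ProdP using ()
open import Data.Sum using (_⊎_; inj₁; inj₂)
open import Data.List as List using (List; []; _∷_; _++_; map; foldr; concatMap; filter; length; deduplicate; allFin)
open import Data.List.Relation.Unary.Unique.Propositional using (Unique)
open import Data.Rational as ℚ using (ℚ; 0ℚ; 1ℚ)
open import Relation.Nullary using (yes; no; ¬?)
open import Relation.Binary.PropositionalEquality using (_≡_)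
open import Relation.Binary.Definitions using (DecidableEquality)

-- Variables x_1..x_n and twins x̄_1..x̄_n (independent variables)

Var : ℕ → Set
Var n = Fin n ⊎ Fin n      -- inj₁ i = x_i ,  inj₂ i = x̄_i

Mono : ℕ → Set
Mono n = Vec ℕ n × Vec ℕ n

_≟M_ : ∀ {n} → DecidableEquality (Mono n)
_≟M_ = ProdP.≡-dec (VecP.≡-dec ℕ._≟_) (VecP.≡-dec ℕ._≟_)

unitMono : ∀ {n} → Mono n
unitMono = replicate _ 0 , replicate _ 0

varMono : ∀ {n} → Var n → Mono n
varMono (inj₁ i) = (replicate _ 0 [ i ]≔ 1) , replicate _ 0
varMono (inj₂ i) = replicate _ 0 , (replicate _ 0 [ i ]≔ 1)

mulMono : ∀ {n} → Mono n → Mono n → Mono n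
mulMono (a , b) (c , d) = zipWith ℕ._+_ a c , zipWith ℕ._+_ b d

degMono : ∀ {n} → Mono n → ℕ
degMono (a , b) = Vec.sum a ℕ.+ Vec.sum b

-- Polynomials with rational coefficients in the 2n variables,
-- represented as (unreduced) lists of terms; equality is equality of
-- all coefficients after collecting like terms.

Poly : ℕ → Set
Poly n = List (ℚ × Mono n)

coeff : ∀ {n} → Poly n → Mono n → ℚ
coeff [] m = 0ℚ
coeff ((c , m′) ∷ p) m with m′ ≟M m
... | yes _ = c ℚ.+ coeff p m
... | no  _ = coeff p m

_≈P_ : ∀ {n} → Poly n → Poly n → Set
p ≈P q = ∀ m → coeff p m ≡ coeff q m

constP : ∀ {n} → ℚ → Poly n
constP c = (c , unitMono) ∷ []

varP : ∀ {n} → Var n → Poly n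
varP v = (1ℚ , varMono v) ∷ []

_+P_ : ∀ {n} → Poly n → Poly n → Poly n
p +P q = p ++ q

negP : ∀ {n} → Poly n → Poly n
negP = map (λ { (c , m) → (ℚ.- c , m) })

_-P_ : ∀ {n} → Poly n → Poly n → Poly n
p -P q = p +P negP q

_*P_ : ∀ {n} → Poly n → Poly n → Poly n
p *P q = concatMap (λ { (c , m) → map (λ { (d , m′) → (c ℚ.* d , mulMono m m′) }) q }) p

infixl 6 _+P_ _-P_
infixl 7 _*P_

prodP : ∀ {n} → List (Poly n) → Poly n
prodP = foldr _*P_ (constP 1ℚ)

sumP : ∀ {n} → List (Poly n) → Poly n
sumP = foldr _+P_ []

support : ∀ {n} → Poly n → List (Mono n)
support p = filter (λ m → ¬? (coeff p m ℚ.≟ 0ℚ)) (deduplicate _≟M_ (map proj₂ p))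

terms : ∀ {n} → Poly n → ℕ
terms p = length (support p)

-- degree of a polynomial (the zero polynomial has degree 0)
degree : ∀ {n} → Poly n → ℕ
degree p = foldr _⊔_ 0 (map degMono (support p))

data Axiom (n : ℕ) (prem : List (Poly n)) : Set where
  premise  : Fin (length prem) → Axiom n prem
  bool₁    : Var n → Axiom n prem
  bool₂    : Var n → Axiom n prem
  compl₁   : Fin n → Axiom n prem
  compl₂   : Fin n → Axiom n prem
  one      : Axiom n prem

axiomP : ∀ {n prem} → Axiom n prem → Poly n
axiomP {prem = prem} (premise j) = List.lookup prem j
axiomP (bool₁ v)  = varP v *P varP v -P varP v
axiomP (bool₂ v)  = varP v -P varP v *P varP v
axiomP (compl₁ i) = constP 1ℚ -P varP (inj₁ i) -P varP (inj₂ i)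
axiomP (compl₂ i) = constP (ℚ.- 1ℚ) +P varP (inj₁ i) +P varP (inj₂ i)
axiomP one        = constP 1ℚ

record Summand (n : ℕ) (prem : List (Poly n)) : Set where
  field
    α     : ℚ
    α≥0   : 0ℚ ℚ.≤ α
    I     : List (Var n)
    J     : List (Var n)
    I-set : Unique I
    J-set : Unique J
    p     : Axiom n prem

expandS : ∀ {n prem} → Summand n prem → Poly n
expandS s = constP α *P prodP (map varP I)
              *P prodP (map (λ v → constP 1ℚ -P varP v) J) *P axiomP p
  where open Summand s

SAR : (n : ℕ) → List (Poly n) → Set
SAR n prem = List (Summand n prem)

-- the derivation D is a derivation of r ≥ 0
Derives : ∀ {n prem} → SAR n prem → Poly n → Set
Derives D r = sumP (map expandS D) ≈P r

rank : ∀ {n prem} → SAR n prem → ℕ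
rank D = foldr _⊔_ 0 (map (λ s → degree (expandS s)) D)

size : ∀ {n prem} → SAR n prem → ℕ
size D = foldr ℕ._+_ 0 (map (λ s → terms (expandS s)) D)

record Clause (n : ℕ) : Set where
  constructor clause
  field
    pos : Subset n
    neg : Subset n
open Clause public

width : ∀ {n} → Clause n → ℕ
width C = ∣ pos C ∣ ℕ.+ ∣ neg C ∣

_∨C_ : ∀ {n} → Clause n → Clause n → Clause n
A ∨C B = clause (pos A ∪ pos B) (neg A ∪ neg B)

_∨pos_ : ∀ {n} → Clause n → Fin n → Clause n
C ∨pos x = clause (⁅ x ⁆ ∪ pos C) (neg C)

_∨neg_ : ∀ {n} → Clause n → Fin n → Clause n
C ∨neg x = clause (pos C) (⁅ x ⁆ ∪ neg C)

M₂ : ∀ {n} → Subset n → Subset n → Poly n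
M₂ {n} Y Z =
  prodP (map (λ i → if Vec.lookup Y i then varP (inj₂ i) else constP 1ℚ) (allFin n))
  *P prodP (map (λ i → if Vec.lookup Z i then varP (inj₁ i) else constP 1ℚ) (allFin n))

MC : ∀ {n} → Clause n → Poly n
MC C = M₂ (pos C) (neg C)

module Submission where

-- Monomials are compared through their exponent functions, so every
-- monomial identity reduces to pointwise arithmetic on exponents.
--
-- Two kinds of summands suffice:
--   M(P)·(1 − y), which telescope to  M(S) − M(S ∪ R)      (weakening),
--   M(S)·(x + x̄ − 1)                                       (complementation).
-- For the resolvent A ∨ B of width w, the target
--   M(A∨x) + M(B∨x̄) − M(A∨B)
-- is the sum of the weakenings M(A∨x) − M(A∨B∨x) and M(B∨x̄) − M(A∨B∨x̄)
-- (rank w+1, size 2(w+1) each) and the complementation of A∨B at x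
-- (rank w+1, size 3); hence rank w+1 and size 4w+7 ≤ 11(1 + w²).

open import Defs
open import Data.Nat using (ℕ; zero; suc; _≤_; _+_; _*_; _⊔_; z≤n; s≤s)
import Data.Nat.Properties as ℕP
open import Data.Nat.Solver using (module +-*-Solver)
open import Data.Fin using (Fin; zero; suc)
open import Data.Fin.Subset using (Subset; _∉_; ⁅_⁆; ∣_∣)
open import Data.Vec as Vec using (Vec; lookup; replicate; _[_]≔_; zipWith)
import Data.Vec.Properties as VecP
open import Data.List using (List; []; _∷_; _++_; _ʳ++_; map; foldr; length; tabulate; allFin; deduplicate)
import Data.List.Properties as ListP
open import Data.List.Relation.Unary.All using (All; []; _∷_)
open import Data.List.Relation.Unary.All.Properties using (filter⁺; deduplicate⁺)
open import Data.List.Relation.Unary.AllPairs using ([]; _∷_)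
open import Data.List.Relation.Unary.Unique.Propositional using (Unique)
open import Data.Bool using (Bool; true; false; _∨_; _∧_; not; if_then_else_)
import Data.Bool.Properties as BoolP
open import Data.Product using (Σ; _×_; _,_; proj₂)
open import Data.Sum using (inj₁; inj₂)
open import Data.Rational as ℚ using (0ℚ; 1ℚ)
import Data.Rational.Properties as ℚP
import Data.Rational.Solver as ℚSolver
open import Relation.Binary.PropositionalEquality
open import Relation.Nullary using (yes; no; ¬?)
open import Data.Empty using (⊥-elim)

⟦_⟧ : Bool → ℕ
⟦ b ⟧ = if b then 1 else 0

⟦⟧≤1 : ∀ b → ⟦ b ⟧ ≤ 1
⟦⟧≤1 true  = s≤s z≤n
⟦⟧≤1 false = z≤n

⟦∨⟧-split : ∀ s r → ⟦ r ∧ not s ⟧ + ⟦ s ⟧ ≡ ⟦ s ∨ r ⟧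
⟦∨⟧-split true  r     = cong (λ b → ⟦ b ⟧ + 1) (BoolP.∧-zeroʳ r)
⟦∨⟧-split false true  = refl
⟦∨⟧-split false false = refl

⟦∨⟧-disjoint : ∀ a b → (a ≡ true → b ≡ false) → ⟦ a ∨ b ⟧ ≡ ⟦ a ⟧ + ⟦ b ⟧
⟦∨⟧-disjoint true  b disj rewrite disj refl = refl
⟦∨⟧-disjoint false b disj = refl

absorbˡ : ∀ s a b → (s ∨ a) ∨ (a ∨ b) ≡ s ∨ (a ∨ b)
absorbˡ true  a     b = refl
absorbˡ false true  b = refl
absorbˡ false false b = refl

absorbʳ : ∀ s a b → (s ∨ b) ∨ (a ∨ b) ≡ s ∨ (a ∨ b)
absorbʳ true  a     b     = refl
absorbʳ false true  true  = refl
absorbʳ false false true  = refl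
absorbʳ false a     false = refl

sameFin : ∀ {n} → Fin n → Fin n → Bool
sameFin zero    zero    = true
sameFin zero    (suc j) = false
sameFin (suc i) zero    = false
sameFin (suc i) (suc j) = sameFin i j

sameFin-refl : ∀ {n} (i : Fin n) → sameFin i i ≡ true
sameFin-refl zero    = refl
sameFin-refl (suc i) = sameFin-refl i

sameFin-sound : ∀ {n} (i j : Fin n) → sameFin i j ≡ true → i ≡ j
sameFin-sound zero    zero    _  = refl
sameFin-sound zero    (suc j) ()
sameFin-sound (suc i) zero    ()
sameFin-sound (suc i) (suc j) eq = cong suc (sameFin-sound i j eq)

sameVar : ∀ {n} → Var n → Var n → Bool
sameVar (inj₁ i) (inj₁ j) = sameFin i j
sameVar (inj₂ i) (inj₂ j) = sameFin i j
sameVar (inj₁ _) (inj₂ _) = false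
sameVar (inj₂ _) (inj₁ _) = false

sameVar-refl : ∀ {n} (v : Var n) → sameVar v v ≡ true
sameVar-refl (inj₁ i) = sameFin-refl i
sameVar-refl (inj₂ i) = sameFin-refl i

sameVar-sound : ∀ {n} (v w : Var n) → sameVar v w ≡ true → v ≡ w
sameVar-sound (inj₁ i) (inj₁ j) eq = cong inj₁ (sameFin-sound i j eq)
sameVar-sound (inj₂ i) (inj₂ j) eq = cong inj₂ (sameFin-sound i j eq)
sameVar-sound (inj₁ i) (inj₂ j) ()
sameVar-sound (inj₂ i) (inj₁ j) ()

lookup-basis : ∀ {n} {A : Set} (a b : A) (i j : Fin n) →
               lookup (replicate n a [ i ]≔ b) j ≡ (if sameFin i j then b else a)
lookup-basis a b zero    zero    = refl
lookup-basis a b zero    (suc j) = VecP.lookup-replicate j a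
lookup-basis a b (suc i) zero    = refl
lookup-basis a b (suc i) (suc j) = lookup-basis a b i j

lookup-⁅⁆ : ∀ {n} (x i : Fin n) → lookup ⁅ x ⁆ i ≡ sameFin x i
lookup-⁅⁆ zero    zero    = refl
lookup-⁅⁆ zero    (suc i) = VecP.lookup-replicate i false
lookup-⁅⁆ (suc x) zero    = refl
lookup-⁅⁆ (suc x) (suc i) = lookup-⁅⁆ x i

exponent : ∀ {n} → Mono n → Var n → ℕ
exponent (a , b) (inj₁ i) = lookup a i
exponent (a , b) (inj₂ i) = lookup b i

monomial-ext : ∀ {n} {m m′ : Mono n} → (∀ v → exponent m v ≡ exponent m′ v) → m ≡ m′
monomial-ext {m = a , b} {c , d} same =
  cong₂ _,_ (vec-ext (λ i → same (inj₁ i))) (vec-ext (λ i → same (inj₂ i)))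
  where
  vec-ext : ∀ {k} {u w : Vec ℕ k} → (∀ i → lookup u i ≡ lookup w i) → u ≡ w
  vec-ext {u = u} {w} eq =
    trans (sym (VecP.tabulate∘lookup u)) (trans (VecP.tabulate-cong eq) (VecP.tabulate∘lookup w))

exponent-mul : ∀ {n} (m m′ : Mono n) v → exponent (mulMono m m′) v ≡ exponent m v + exponent m′ v
exponent-mul (a , b) (c , d) (inj₁ i) = VecP.lookup-zipWith _+_ i a c
exponent-mul (a , b) (c , d) (inj₂ i) = VecP.lookup-zipWith _+_ i b d

exponent-unit : ∀ {n} (v : Var n) → exponent unitMono v ≡ 0
exponent-unit (inj₁ i) = VecP.lookup-replicate i 0
exponent-unit (inj₂ i) = VecP.lookup-replicate i 0

exponent-var : ∀ {n} (w v : Var n) → exponent (varMono w) v ≡ ⟦ sameVar w v ⟧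
exponent-var (inj₁ i) (inj₁ j) = lookup-basis 0 1 i j
exponent-var (inj₁ i) (inj₂ j) = VecP.lookup-replicate j 0
exponent-var (inj₂ i) (inj₁ j) = VecP.lookup-replicate j 0
exponent-var (inj₂ i) (inj₂ j) = lookup-basis 0 1 i j

mulMono-identityˡ : ∀ {n} (m : Mono n) → mulMono unitMono m ≡ m
mulMono-identityˡ m = monomial-ext λ v →
  trans (exponent-mul unitMono m v) (cong (_+ exponent m v) (exponent-unit v))

mulMono-identityʳ : ∀ {n} (m : Mono n) → mulMono m unitMono ≡ m
mulMono-identityʳ m = monomial-ext λ v →
  trans (exponent-mul m unitMono v)
        (trans (cong (exponent m v +_) (exponent-unit v)) (ℕP.+-identityʳ _))

mulMono-comm : ∀ {n} (m m′ : Mono n) → mulMono m m′ ≡ mulMono m′ m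
mulMono-comm m m′ = monomial-ext λ v →
  trans (exponent-mul m m′ v) (trans (ℕP.+-comm (exponent m v) (exponent m′ v)) (sym (exponent-mul m′ m v)))

interchange : ∀ a b c d → (a + b) + (c + d) ≡ (a + c) + (b + d)
interchange = solve 4 (λ a b c d → (a :+ b) :+ (c :+ d) := (a :+ c) :+ (b :+ d)) refl
  where open +-*-Solver

sum-zipWith : ∀ {k} (u w : Vec ℕ k) → Vec.sum (zipWith _+_ u w) ≡ Vec.sum u + Vec.sum w
sum-zipWith Vec.[]       Vec.[]       = refl
sum-zipWith (x Vec.∷ u) (y Vec.∷ w) =
  trans (cong (x + y +_) (sum-zipWith u w)) (interchange x y (Vec.sum u) (Vec.sum w))

sum-zeros : ∀ k → Vec.sum (replicate k 0) ≡ 0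
sum-zeros zero    = refl
sum-zeros (suc k) = sum-zeros k

sum-basis : ∀ {k} (i : Fin k) → Vec.sum (replicate k 0 [ i ]≔ 1) ≡ 1
sum-basis {suc k} zero    = cong suc (sum-zeros k)
sum-basis {suc k} (suc i) = sum-basis i

degMono-unit : ∀ {n} → degMono (unitMono {n}) ≡ 0
degMono-unit {n} = cong₂ _+_ (sum-zeros n) (sum-zeros n)

degMono-var : ∀ {n} (w : Var n) → degMono (varMono w) ≡ 1
degMono-var {n} (inj₁ i) = cong₂ _+_ (sum-basis i) (sum-zeros n)
degMono-var {n} (inj₂ i) = cong₂ _+_ (sum-zeros n) (sum-basis i)

degMono-mul : ∀ {n} (m m′ : Mono n) → degMono (mulMono m m′) ≡ degMono m + degMono m′
degMono-mul (a , b) (c , d) =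
  trans (cong₂ _+_ (sum-zipWith a c) (sum-zipWith b d))
        (interchange (Vec.sum a) (Vec.sum c) (Vec.sum b) (Vec.sum d))

occ : ∀ {n} → Var n → List (Var n) → ℕ
occ v []      = 0
occ v (w ∷ L) = ⟦ sameVar w v ⟧ + occ v L

listMono : ∀ {n} → List (Var n) → Mono n
listMono []      = unitMono
listMono (w ∷ L) = mulMono (varMono w) (listMono L)

exponent-listMono : ∀ {n} (L : List (Var n)) v → exponent (listMono L) v ≡ occ v L
exponent-listMono []      v = exponent-unit v
exponent-listMono (w ∷ L) v =
  trans (exponent-mul (varMono w) (listMono L) v)
        (cong₂ _+_ (exponent-var w v) (exponent-listMono L v))

degMono-listMono : ∀ {n} (L : List (Var n)) → degMono (listMono L) ≡ length L
degMono-listMono {n} []      = degMono-unit {n}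
degMono-listMono (w ∷ L) =
  trans (degMono-mul (varMono w) (listMono L))
        (cong₂ _+_ (degMono-var w) (degMono-listMono L))

length-by-monomial : ∀ {n} (L K : List (Var n)) → listMono L ≡ listMono K → length L ≡ length K
length-by-monomial L K eq =
  trans (sym (degMono-listMono L)) (trans (cong degMono eq) (degMono-listMono K))

occ-++ : ∀ {n} (v : Var n) L K → occ v (L ++ K) ≡ occ v L + occ v K
occ-++ v []      K = refl
occ-++ v (w ∷ L) K = trans (cong (⟦ sameVar w v ⟧ +_) (occ-++ v L K)) (sym (ℕP.+-assoc ⟦ sameVar w v ⟧ (occ v L) (occ v K)))

occ-ʳ++ : ∀ {n} (v : Var n) K L → occ v (K ʳ++ L) ≡ occ v K + occ v L
occ-ʳ++ v []      L = refl
occ-ʳ++ v (w ∷ K) L =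
  trans (occ-ʳ++ v K (w ∷ L))
        (trans (sym (ℕP.+-assoc (occ v K) _ _))
               (cong (_+ occ v L) (ℕP.+-comm (occ v K) ⟦ sameVar w v ⟧)))

listMono-++ : ∀ {n} (L K : List (Var n)) → listMono (L ++ K) ≡ mulMono (listMono L) (listMono K)
listMono-++ L K = monomial-ext λ v → begin
  exponent (listMono (L ++ K)) v                    ≡⟨ exponent-listMono (L ++ K) v ⟩
  occ v (L ++ K)                                    ≡⟨ occ-++ v L K ⟩
  occ v L + occ v K                                 ≡⟨ sym (cong₂ _+_ (exponent-listMono L v) (exponent-listMono K v)) ⟩
  exponent (listMono L) v + exponent (listMono K) v ≡⟨ sym (exponent-mul (listMono L) (listMono K) v) ⟩
  exponent (mulMono (listMono L) (listMono K)) v    ∎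
  where open ≡-Reasoning

-- No variable occurs twice in L; such lists are duplicate-free (Unique),
-- as the index sets I of summands must be.
NoRepeats : ∀ {n} → List (Var n) → Set
NoRepeats L = ∀ v → occ v L ≤ 1

noRepeats⇒unique : ∀ {n} (L : List (Var n)) → NoRepeats L → Unique L
noRepeats⇒unique []      _  = []
noRepeats⇒unique (w ∷ L) nr =
  absent w L (ℕP.n≤0⇒n≡0 (ℕP.≤-pred (subst (λ b → ⟦ b ⟧ + occ w L ≤ 1) (sameVar-refl w) (nr w))))
  ∷ noRepeats⇒unique L (λ v → ℕP.≤-trans (ℕP.m≤n+m (occ v L) _) (nr v))
  where
  absent : ∀ w L → occ w L ≡ 0 → All (λ u → w ≢ u) L
  absent w []      _    = []
  absent w (u ∷ L) none = w≢u ∷ absent w L (ℕP.m+n≡0⇒n≡0 ⟦ sameVar u w ⟧ none)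
    where
    w≢u : w ≢ u
    w≢u refl = ℕP.1+n≢0 (trans (cong ⟦_⟧ (sym (sameVar-refl w))) (ℕP.m+n≡0⇒m≡0 _ none))

VarSet : ℕ → Set
VarSet n = Var n → Bool

⁅_⁆ᵛ : ∀ {n} → Var n → VarSet n
⁅ v ⁆ᵛ = sameVar v

_∪ᵛ_ : ∀ {n} → VarSet n → VarSet n → VarSet n
(S ∪ᵛ R) v = S v ∨ R v

_∖ᵛ_ : ∀ {n} → VarSet n → VarSet n → VarSet n
(R ∖ᵛ S) v = R v ∧ not (S v)

selected : ∀ {k n} → (Fin k → Var n) → Subset k → List (Var n)
selected g Vec.[]          = []
selected g (true  Vec.∷ Y) = g zero ∷ selected (λ i → g (suc i)) Y
selected g (false Vec.∷ Y) = selected (λ i → g (suc i)) Y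

length-selected : ∀ {k n} (g : Fin k → Var n) (Y : Subset k) → length (selected g Y) ≡ ∣ Y ∣
length-selected g Vec.[]          = refl
length-selected g (true  Vec.∷ Y) = cong suc (length-selected (λ i → g (suc i)) Y)
length-selected g (false Vec.∷ Y) = length-selected (λ i → g (suc i)) Y

occ-selected-outside : ∀ {k n} (g : Fin k → Var n) (Y : Subset k) {v} →
                       (∀ i → sameVar (g i) v ≡ false) → occ v (selected g Y) ≡ 0
occ-selected-outside g Vec.[]          out = refl
occ-selected-outside g (true  Vec.∷ Y) out =
  cong₂ _+_ (cong ⟦_⟧ (out zero)) (occ-selected-outside (λ i → g (suc i)) Y (λ i → out (suc i)))
occ-selected-outside g (false Vec.∷ Y) out =
  occ-selected-outside (λ i → g (suc i)) Y (λ i → out (suc i))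

occ-selected : ∀ {k n} (g : Fin k → Var n) (Y : Subset k) →
               (∀ i j → sameVar (g i) (g j) ≡ sameFin i j) →
               ∀ j → occ (g j) (selected g Y) ≡ ⟦ lookup Y j ⟧
occ-selected g (true  Vec.∷ Y) inj zero =
  cong₂ _+_ (cong ⟦_⟧ (inj zero zero)) (occ-selected-outside (λ i → g (suc i)) Y (λ i → inj (suc i) zero))
occ-selected g (true  Vec.∷ Y) inj (suc j) =
  cong₂ _+_ (cong ⟦_⟧ (inj zero (suc j))) (occ-selected (λ i → g (suc i)) Y (λ i j → inj (suc i) (suc j)) j)
occ-selected g (false Vec.∷ Y) inj zero =
  occ-selected-outside (λ i → g (suc i)) Y (λ i → inj (suc i) zero)
occ-selected g (false Vec.∷ Y) inj (suc j) =
  occ-selected (λ i → g (suc i)) Y (λ i j → inj (suc i) (suc j)) j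

varsOf : ∀ {n} → VarSet n → List (Var n)
varsOf S = selected inj₂ (Vec.tabulate (λ i → S (inj₂ i))) ++ selected inj₁ (Vec.tabulate (λ i → S (inj₁ i)))

occ-varsOf : ∀ {n} (S : VarSet n) v → occ v (varsOf S) ≡ ⟦ S v ⟧
occ-varsOf S (inj₁ j) =
  trans (occ-++ (inj₁ j) (selected inj₂ T₂) (selected inj₁ T₁))
        (cong₂ _+_ (occ-selected-outside inj₂ T₂ (λ _ → refl))
                   (trans (occ-selected inj₁ T₁ (λ _ _ → refl) j) (cong ⟦_⟧ (VecP.lookup∘tabulate _ j))))
  where
  T₁ = Vec.tabulate (λ i → S (inj₁ i))
  T₂ = Vec.tabulate (λ i → S (inj₂ i))
occ-varsOf S (inj₂ j) =
  trans (occ-++ (inj₂ j) (selected inj₂ T₂) (selected inj₁ T₁))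
        (trans (cong₂ _+_ (trans (occ-selected inj₂ T₂ (λ _ _ → refl) j) (cong ⟦_⟧ (VecP.lookup∘tabulate _ j)))
                          (occ-selected-outside inj₁ T₁ (λ _ → refl)))
               (ℕP.+-identityʳ _))
  where
  T₁ = Vec.tabulate (λ i → S (inj₁ i))
  T₂ = Vec.tabulate (λ i → S (inj₂ i))

unique-varsOf : ∀ {n} (S : VarSet n) → Unique (varsOf S)
unique-varsOf S = noRepeats⇒unique (varsOf S) λ v → subst (_≤ 1) (sym (occ-varsOf S v)) (⟦⟧≤1 (S v))

setMono : ∀ {n} → VarSet n → Mono n
setMono S = listMono (varsOf S)

card : ∀ {n} → VarSet n → ℕ
card S = length (varsOf S)

exponent-setMono : ∀ {n} (S : VarSet n) v → exponent (setMono S) v ≡ ⟦ S v ⟧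
exponent-setMono S v = trans (exponent-listMono (varsOf S) v) (occ-varsOf S v)

setMono-cong : ∀ {n} {S T : VarSet n} → S ≗ T → setMono S ≡ setMono T
setMono-cong {S = S} {T} S≗T = monomial-ext λ v →
  trans (exponent-setMono S v) (trans (cong ⟦_⟧ (S≗T v)) (sym (exponent-setMono T v)))

card-cong : ∀ {n} {S T : VarSet n} → S ≗ T → card S ≡ card T
card-cong {S = S} {T} S≗T = length-by-monomial (varsOf S) (varsOf T) (setMono-cong S≗T)

setMono-insert : ∀ {n} (S : VarSet n) {v} → S v ≡ false → listMono (v ∷ varsOf S) ≡ setMono (⁅ v ⁆ᵛ ∪ᵛ S)
setMono-insert S {v} v∉S = monomial-ext λ u →
  trans (exponent-listMono (v ∷ varsOf S) u)
        (trans (cong (⟦ sameVar v u ⟧ +_) (occ-varsOf S u))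
               (trans (sym (⟦∨⟧-disjoint (sameVar v u) (S u) (λ same → subst (λ w → S w ≡ false) (sameVar-sound v u same) v∉S)))
                      (sym (exponent-setMono (⁅ v ⁆ᵛ ∪ᵛ S) u))))

card-insert : ∀ {n} (S : VarSet n) {v} → S v ≡ false → card (⁅ v ⁆ᵛ ∪ᵛ S) ≡ suc (card S)
card-insert S {v} v∉S = sym (length-by-monomial (v ∷ varsOf S) (varsOf (⁅ v ⁆ᵛ ∪ᵛ S)) (setMono-insert S v∉S))

term : ∀ {n} → Mono n → Poly n
term m = (1ℚ , m) ∷ []

prodP-varP : ∀ {n} (L : List (Var n)) → prodP (map varP L) ≡ term (listMono L)
prodP-varP []      = refl
prodP-varP (w ∷ L) rewrite prodP-varP L = refl

≡⇒≈P : ∀ {n} {p q : Poly n} → p ≡ q → p ≈P q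
≡⇒≈P eq m = cong (λ r → coeff r m) eq

-- Coefficients are additive, which makes ≈P a linear-algebra statement.
coeff-+P : ∀ {n} (p q : Poly n) m → coeff (p +P q) m ≡ coeff p m ℚ.+ coeff q m
coeff-+P []            q m = sym (ℚP.+-identityˡ _)
coeff-+P ((c , a) ∷ p) q m with a ≟M m
... | yes _ = trans (cong (c ℚ.+_) (coeff-+P p q m)) (sym (ℚP.+-assoc c _ _))
... | no  _ = coeff-+P p q m

coeff-negP : ∀ {n} (p : Poly n) m → coeff (negP p) m ≡ ℚ.- coeff p m
coeff-negP []            m = refl
coeff-negP ((c , a) ∷ p) m with a ≟M m
... | yes _ = trans (cong (ℚ.- c ℚ.+_) (coeff-negP p m)) (sym (ℚP.neg-distrib-+ c _))
... | no  _ = coeff-negP p m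

-- Evaluating the coefficient of a polynomial expression step by step; the
-- identities below then follow by the ring solver on ℚ.
+ᶜ : ∀ {n} (p q : Poly n) {m a b} → coeff p m ≡ a → coeff q m ≡ b → coeff (p +P q) m ≡ a ℚ.+ b
+ᶜ p q {m} ea eb = trans (coeff-+P p q m) (cong₂ ℚ._+_ ea eb)

negᶜ : ∀ {n} (p : Poly n) {m a} → coeff p m ≡ a → coeff (negP p) m ≡ ℚ.- a
negᶜ p {m} ea = trans (coeff-negP p m) (cong ℚ.-_ ea)

-ᶜ : ∀ {n} (p q : Poly n) {m a b} → coeff p m ≡ a → coeff q m ≡ b → coeff (p -P q) m ≡ a ℚ.- b
-ᶜ p q ea eb = +ᶜ p (negP q) ea (negᶜ q eb)

cancel : ∀ {n} (p : Poly n) → [] ≈P (p -P p)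
cancel p m = sym (trans (-ᶜ p p refl refl) (ℚP.+-inverseʳ (coeff p m)))

telescope-identity : ∀ {n} (p q r : Poly n) → ((p -P q) +P (q -P r)) ≈P (p -P r)
telescope-identity p q r m =
  trans (+ᶜ (p -P q) (q -P r) (-ᶜ p q refl refl) (-ᶜ q r refl refl))
        (trans (solve 3 (λ a b c → (a :- b) :+ (b :- c) := a :- c) refl (coeff p m) (coeff q m) (coeff r m))
               (sym (-ᶜ p r refl refl)))
  where open ℚSolver.+-*-Solver

cut-identity : ∀ {n} (p₁ p₂ p₃ q₁ q₂ : Poly n) →
               ((p₁ -P q₁) +P (p₂ -P q₂) +P (negP p₃ +P q₂ +P q₁)) ≈P (p₁ +P p₂ -P p₃)
cut-identity p₁ p₂ p₃ q₁ q₂ m =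
  trans (+ᶜ ((p₁ -P q₁) +P (p₂ -P q₂)) (negP p₃ +P q₂ +P q₁)
            (+ᶜ (p₁ -P q₁) (p₂ -P q₂) (-ᶜ p₁ q₁ refl refl) (-ᶜ p₂ q₂ refl refl))
            (+ᶜ (negP p₃ +P q₂) q₁ (+ᶜ (negP p₃) q₂ (negᶜ p₃ refl) refl) refl))
        (trans (solve 5 (λ a₁ a₂ a₃ b₁ b₂ → ((a₁ :- b₁) :+ (a₂ :- b₂)) :+ (((:- a₃) :+ b₂) :+ b₁)
                                             := (a₁ :+ a₂) :- a₃)
                      refl (coeff p₁ m) (coeff p₂ m) (coeff p₃ m) (coeff q₁ m) (coeff q₂ m))
               (sym (-ᶜ (p₁ +P p₂) p₃ (+ᶜ p₁ p₂ refl refl) refl)))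
  where open ℚSolver.+-*-Solver

degree≤ : ∀ {n} (p : Poly n) {r} → All (λ a → degMono a ≤ r) (map proj₂ p) → degree p ≤ r
degree≤ p {r} bounded = max≤ (filter⁺ _ (deduplicate⁺ _≟M_ bounded))
  where
  max≤ : ∀ {S} → All (λ a → degMono a ≤ r) S → foldr _⊔_ 0 (map degMono S) ≤ r
  max≤ []       = z≤n
  max≤ (h ∷ hs) = ℕP.⊔-lub h (max≤ hs)

terms≤length : ∀ {n} (p : Poly n) → terms p ≤ length p
terms≤length p =
  ℕP.≤-trans (ListP.length-filter (λ m → ¬? (coeff p m ℚ.≟ 0ℚ)) (deduplicate _≟M_ (map proj₂ p)))
  (ℕP.≤-trans (ListP.length-deduplicate _≟M_ (map proj₂ p)) (ℕP.≤-reflexive (ListP.length-map proj₂ p)))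

record Derivation {n} (prem : List (Poly n)) (r : Poly n) (d s : ℕ) : Set where
  constructor derivation
  field
    steps   : SAR n prem
    derives : Derives steps r
    rank≤   : rank steps ≤ d
    size≤   : size steps ≤ s

unpack : ∀ {n prem} {r : Poly n} {d s} → Derivation prem r d s →
         Σ (SAR n prem) λ D → Derives D r × rank D ≤ d × size D ≤ s
unpack (derivation D der rankD sizeD) = D , der , rankD , sizeD

sumP-++ : ∀ {n prem} (D E : SAR n prem) →
          sumP (map expandS (D ++ E)) ≡ sumP (map expandS D) +P sumP (map expandS E)
sumP-++ []      E = refl
sumP-++ (σ ∷ D) E = trans (cong (expandS σ +P_) (sumP-++ D E)) (sym (ListP.++-assoc (expandS σ) _ _))

rank-++ : ∀ {n prem} (D E : SAR n prem) → rank (D ++ E) ≡ rank D ⊔ rank E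
rank-++ []      E = refl
rank-++ (σ ∷ D) E = trans (cong (degree (expandS σ) ⊔_) (rank-++ D E)) (sym (ℕP.⊔-assoc (degree (expandS σ)) _ _))

size-++ : ∀ {n prem} (D E : SAR n prem) → size (D ++ E) ≡ size D + size E
size-++ []      E = refl
size-++ (σ ∷ D) E = trans (cong (terms (expandS σ) +_) (size-++ D E)) (sym (ℕP.+-assoc (terms (expandS σ)) _ _))

infixl 5 _⊕_
_⊕_ : ∀ {n prem} {r₁ r₂ : Poly n} {d s₁ s₂} →
      Derivation prem r₁ d s₁ → Derivation prem r₂ d s₂ → Derivation prem (r₁ +P r₂) d (s₁ + s₂)
_⊕_ {r₁ = r₁} {r₂} (derivation D derD rankD sizeD) (derivation E derE rankE sizeE) =
  derivation (D ++ E)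
  (λ m → begin
    coeff (sumP (map expandS (D ++ E))) m                             ≡⟨ ≡⇒≈P (sumP-++ D E) m ⟩
    coeff (sumP (map expandS D) +P sumP (map expandS E)) m            ≡⟨ coeff-+P (sumP (map expandS D)) (sumP (map expandS E)) m ⟩
    coeff (sumP (map expandS D)) m ℚ.+ coeff (sumP (map expandS E)) m ≡⟨ cong₂ ℚ._+_ (derD m) (derE m) ⟩
    coeff r₁ m ℚ.+ coeff r₂ m                                         ≡⟨ sym (coeff-+P r₁ r₂ m) ⟩
    coeff (r₁ +P r₂) m                                                ∎)
  (subst (_≤ _) (sym (rank-++ D E)) (ℕP.⊔-lub rankD rankE))
  (subst (_≤ _) (sym (size-++ D E)) (ℕP.+-mono-≤ sizeD sizeE))
  where open ≡-Reasoning

adjust : ∀ {n prem} {r r′ : Poly n} {d d′ s s′} →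
         Derivation prem r d s → r ≈P r′ → d ≤ d′ → s ≤ s′ → Derivation prem r′ d′ s′
adjust (derivation D der rankD sizeD) r≈r′ d≤d′ s≤s′ =
  derivation D (λ m → trans (der m) (r≈r′ m)) (ℕP.≤-trans rankD d≤d′) (ℕP.≤-trans sizeD s≤s′)

noSteps : ∀ {n prem} → Derivation {n} prem [] 0 0
noSteps = derivation [] (λ _ → refl) z≤n z≤n

summand : ∀ {n prem} (σ : Summand n prem) {r d s} → expandS σ ≡ r →
          degree r ≤ d → terms r ≤ s → Derivation prem r d s
summand σ refl deg≤ terms≤ =
  derivation (σ ∷ [])
    (≡⇒≈P (ListP.++-identityʳ (expandS σ)))
    (ℕP.≤-trans (ℕP.≤-reflexive (ℕP.⊔-identityʳ _)) deg≤)
    (ℕP.≤-trans (ℕP.≤-reflexive (ℕP.+-identityʳ _)) terms≤)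

0≤1 : 0ℚ ℚ.≤ 1ℚ
0≤1 = ℚP.nonNegative⁻¹ 1ℚ

weakenStep : ∀ {n prem} (P : List (Var n)) (y : Var n) → Unique P → Summand n prem
weakenStep P y uniq = record
  { α = 1ℚ ; α≥0 = 0≤1 ; I = P ; J = y ∷ [] ; I-set = uniq ; J-set = [] ∷ [] ; p = one }

expand-weakenStep : ∀ {n prem} (P : List (Var n)) y uniq →
  expandS (weakenStep {prem = prem} P y uniq) ≡ term (listMono P) -P term (listMono (y ∷ P))
expand-weakenStep {n} P y uniq rewrite prodP-varP P =
  cong₂ (λ a b → (1ℚ , a) ∷ (ℚ.- 1ℚ , b) ∷ []) keep extend
  where
  U = unitMono {n}
  keep : mulMono (mulMono (mulMono U (listMono P)) (mulMono U U)) U ≡ listMono P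
  keep = trans (mulMono-identityʳ _)
               (trans (cong₂ mulMono (mulMono-identityˡ _) (mulMono-identityʳ U)) (mulMono-identityʳ _))
  extend : mulMono (mulMono (mulMono U (listMono P)) (mulMono (varMono y) U)) U ≡ listMono (y ∷ P)
  extend = trans (mulMono-identityʳ _)
                 (trans (cong₂ mulMono (mulMono-identityˡ _) (mulMono-identityʳ _))
                        (mulMono-comm (listMono P) (varMono y)))

complementStep : ∀ {n prem} (P : List (Var n)) (x : Fin n) → Unique P → Summand n prem
complementStep P x uniq = record
  { α = 1ℚ ; α≥0 = 0≤1 ; I = P ; J = [] ; I-set = uniq ; J-set = [] ; p = compl₂ x }

expand-complementStep : ∀ {n prem} (P : List (Var n)) x uniq →
  expandS (complementStep {prem = prem} P x uniq)
    ≡ negP (term (listMono P)) +P term (listMono (inj₁ x ∷ P)) +P term (listMono (inj₂ x ∷ P))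
expand-complementStep {n} P x uniq rewrite prodP-varP P =
  cong₂ (λ a rest → (ℚ.- 1ℚ , a) ∷ rest)
        (trans (times U) (mulMono-identityˡ (listMono P)))
        (cong₂ (λ b c → (1ℚ , b) ∷ (1ℚ , c) ∷ []) (times (varMono (inj₁ x))) (times (varMono (inj₂ x))))
  where
  U = unitMono {n}
  times : ∀ a → mulMono (mulMono (mulMono U (listMono P)) U) a ≡ mulMono a (listMono P)
  times a = trans (cong (λ m → mulMono m a) (trans (mulMono-identityʳ _) (mulMono-identityˡ (listMono P))))
                  (mulMono-comm (listMono P) a)

deg-listMono≤ : ∀ {n} (L : List (Var n)) {d} → length L ≤ d → degMono (listMono L) ≤ d
deg-listMono≤ L len≤ = ℕP.≤-trans (ℕP.≤-reflexive (degMono-listMono L)) len≤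

weakenStep-derivation : ∀ {n prem} (P : List (Var n)) (y : Var n) {d} → Unique P → suc (length P) ≤ d →
  Derivation prem (term (listMono P) -P term (listMono (y ∷ P))) d 2
weakenStep-derivation {prem = prem} P y uniq len≤ =
  summand (weakenStep P y uniq) (expand-weakenStep {prem = prem} P y uniq)
    (degree≤ (term (listMono P) -P term (listMono (y ∷ P)))
       (deg-listMono≤ P (ℕP.<⇒≤ len≤) ∷ deg-listMono≤ (y ∷ P) len≤ ∷ []))
    (terms≤length (term (listMono P) -P term (listMono (y ∷ P))))

complementStep-derivation : ∀ {n prem} (P : List (Var n)) (x : Fin n) → Unique P →
  Derivation prem (negP (term (listMono P)) +P term (listMono (inj₁ x ∷ P)) +P term (listMono (inj₂ x ∷ P)))
             (suc (length P)) 3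
complementStep-derivation {prem = prem} P x uniq =
  summand (complementStep P x uniq) (expand-complementStep {prem = prem} P x uniq)
    (degree≤ (negP (term (listMono P)) +P term (listMono (inj₁ x ∷ P)) +P term (listMono (inj₂ x ∷ P)))
       (deg-listMono≤ P (ℕP.n≤1+n _) ∷ deg-listMono≤ (inj₁ x ∷ P) ℕP.≤-refl ∷ deg-listMono≤ (inj₂ x ∷ P) ℕP.≤-refl ∷ []))
    (terms≤length (negP (term (listMono P)) +P term (listMono (inj₁ x ∷ P)) +P term (listMono (inj₂ x ∷ P))))

-- Multiplying M(P) in turn by (1 − y) for y ∈ Q telescopes:
--   M(P) − M(P ∪ Q) = Σ_k M(P ∪ {y₁,…,y_{k−1}})·(1 − y_k).
telescope : ∀ {n prem} (P Q : List (Var n)) → NoRepeats (Q ʳ++ P) →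
  Derivation prem (term (listMono P) -P term (listMono (Q ʳ++ P))) (length (Q ʳ++ P)) (2 * length Q)
telescope P []      _  = adjust noSteps (cancel (term (listMono P))) z≤n z≤n
telescope P (y ∷ Q) nr =
  adjust (weakenStep-derivation P y (noRepeats⇒unique P nrP) step≤ ⊕ telescope (y ∷ P) Q nr)
         (telescope-identity (term (listMono P)) (term (listMono (y ∷ P))) (term (listMono (Q ʳ++ (y ∷ P)))))
         ℕP.≤-refl (ℕP.≤-reflexive (sym (ℕP.*-suc 2 (length Q))))
  where
  nrP : NoRepeats P
  nrP v = ℕP.≤-trans (ℕP.m≤n+m (occ v P) (occ v (y ∷ Q))) (subst (_≤ 1) (occ-ʳ++ v (y ∷ Q) P) (nr v))
  step≤ : suc (length P) ≤ length (Q ʳ++ (y ∷ P))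
  step≤ = ℕP.≤-trans (ℕP.m≤n+m (suc (length P)) (length Q)) (ℕP.≤-reflexive (sym (ListP.length-ʳ++ Q)))

-- M(S) − M(S ∪ R) ≥ 0, by telescoping over the elements of R outside S.
weakening : ∀ {n prem} (S R : VarSet n) →
  Derivation prem (term (setMono S) -P term (setMono (S ∪ᵛ R))) (card (S ∪ᵛ R)) (2 * card (S ∪ᵛ R))
weakening S R =
  adjust (telescope P Q nr)
         (≡⇒≈P (cong (λ m → term (setMono S) -P term m) final≡))
         (ℕP.≤-reflexive length≡) (ℕP.*-monoʳ-≤ 2 new≤)
  where
  P = varsOf S
  Q = varsOf (R ∖ᵛ S)
  occ-final : ∀ v → occ v (Q ʳ++ P) ≡ ⟦ S v ∨ R v ⟧
  occ-final v = trans (occ-ʳ++ v Q P)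
                      (trans (cong₂ _+_ (occ-varsOf (R ∖ᵛ S) v) (occ-varsOf S v)) (⟦∨⟧-split (S v) (R v)))
  nr : NoRepeats (Q ʳ++ P)
  nr v = subst (_≤ 1) (sym (occ-final v)) (⟦⟧≤1 _)
  final≡ : listMono (Q ʳ++ P) ≡ setMono (S ∪ᵛ R)
  final≡ = monomial-ext λ v →
    trans (exponent-listMono (Q ʳ++ P) v) (trans (occ-final v) (sym (exponent-setMono (S ∪ᵛ R) v)))
  length≡ : length (Q ʳ++ P) ≡ card (S ∪ᵛ R)
  length≡ = length-by-monomial (Q ʳ++ P) (varsOf (S ∪ᵛ R)) final≡
  new≤ : length Q ≤ card (S ∪ᵛ R)
  new≤ = ℕP.≤-trans (ℕP.m≤m+n (length Q) (length P)) (ℕP.≤-reflexive (trans (sym (ListP.length-ʳ++ Q)) length≡))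

complementation : ∀ {n prem} (S : VarSet n) (x : Fin n) → S (inj₁ x) ≡ false → S (inj₂ x) ≡ false →
  Derivation prem (negP (term (setMono S)) +P term (setMono (⁅ inj₁ x ⁆ᵛ ∪ᵛ S)) +P term (setMono (⁅ inj₂ x ⁆ᵛ ∪ᵛ S)))
             (suc (card S)) 3
complementation S x x∉S x̄∉S =
  adjust (complementStep-derivation (varsOf S) x (unique-varsOf S))
         (≡⇒≈P (cong₂ (λ a b → negP (term (setMono S)) +P term a +P term b)
                      (setMono-insert S x∉S) (setMono-insert S x̄∉S)))
         ℕP.≤-refl ℕP.≤-refl

-- The variables of the clause monomial M(C): ȳ for a positive literal y,
-- z for a negative literal z.
lits : ∀ {n} → Clause n → VarSet n
lits C (inj₁ i) = lookup (neg C) i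
lits C (inj₂ i) = lookup (pos C) i

varsOf-lits : ∀ {n} (C : Clause n) → varsOf (lits C) ≡ selected inj₂ (pos C) ++ selected inj₁ (neg C)
varsOf-lits C = cong₂ (λ Y Z → selected inj₂ Y ++ selected inj₁ Z)
                      (VecP.tabulate∘lookup (pos C)) (VecP.tabulate∘lookup (neg C))

card-lits : ∀ {n} (C : Clause n) → card (lits C) ≡ width C
card-lits C =
  trans (cong length (varsOf-lits C))
        (trans (ListP.length-++ (selected inj₂ (pos C)))
               (cong₂ _+_ (length-selected inj₂ (pos C)) (length-selected inj₁ (neg C))))

prodP-selected : ∀ {k n} (Y : Subset k) (g : Fin k → Var n) →
  prodP (tabulate (λ i → if lookup Y i then varP (g i) else constP 1ℚ)) ≡ term (listMono (selected g Y))
prodP-selected Vec.[]          g = refl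
prodP-selected (true  Vec.∷ Y) g rewrite prodP-selected Y (λ i → g (suc i)) = refl
prodP-selected (false Vec.∷ Y) g rewrite prodP-selected Y (λ i → g (suc i)) =
  cong term (mulMono-identityˡ (listMono (selected (λ i → g (suc i)) Y)))

MC-setMono : ∀ {n} (C : Clause n) → MC C ≡ term (setMono (lits C))
MC-setMono {n} C = begin
  MC C
    ≡⟨ cong₂ _*P_ (product (pos C) inj₂) (product (neg C) inj₁) ⟩
  term (mulMono (listMono (selected inj₂ (pos C))) (listMono (selected inj₁ (neg C))))
    ≡⟨ cong term (sym (listMono-++ (selected inj₂ (pos C)) (selected inj₁ (neg C)))) ⟩
  term (listMono (selected inj₂ (pos C) ++ selected inj₁ (neg C)))
    ≡⟨ cong (λ L → term (listMono L)) (sym (varsOf-lits C)) ⟩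
  term (setMono (lits C))
    ∎
  where
  open ≡-Reasoning
  product : (Y : Subset n) (g : Fin n → Var n) →
    prodP (map (λ i → if lookup Y i then varP (g i) else constP 1ℚ) (allFin n)) ≡ term (listMono (selected g Y))
  product Y g = trans (cong prodP (ListP.map-tabulate (λ i → i) (λ i → if lookup Y i then varP (g i) else constP 1ℚ)))
                      (prodP-selected Y g)

lits-∨C : ∀ {n} (A B : Clause n) → lits (A ∨C B) ≗ (lits A ∪ᵛ lits B)
lits-∨C A B (inj₁ i) = VecP.lookup-zipWith _∨_ i (neg A) (neg B)
lits-∨C A B (inj₂ i) = VecP.lookup-zipWith _∨_ i (pos A) (pos B)

lits-∨pos : ∀ {n} (C : Clause n) x → lits (C ∨pos x) ≗ (⁅ inj₂ x ⁆ᵛ ∪ᵛ lits C)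
lits-∨pos C x (inj₁ i) = refl
lits-∨pos C x (inj₂ i) =
  trans (VecP.lookup-zipWith _∨_ i ⁅ x ⁆ (pos C)) (cong (_∨ lookup (pos C) i) (lookup-⁅⁆ x i))

lits-∨neg : ∀ {n} (C : Clause n) x → lits (C ∨neg x) ≗ (⁅ inj₁ x ⁆ᵛ ∪ᵛ lits C)
lits-∨neg C x (inj₁ i) =
  trans (VecP.lookup-zipWith _∨_ i ⁅ x ⁆ (neg C)) (cong (_∨ lookup (neg C) i) (lookup-⁅⁆ x i))
lits-∨neg C x (inj₂ i) = refl

∉⇒false : ∀ {n} {x : Fin n} {Y : Subset n} → x ∉ Y → lookup Y x ≡ false
∉⇒false {x = x} {Y} x∉Y with lookup Y x in eq
... | false = refl
... | true  = ⊥-elim (x∉Y (VecP.lookup⇒[]= x Y eq))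

fresh-∨C : ∀ {n} (A B : Clause n) v → lits A v ≡ false → lits B v ≡ false → lits (A ∨C B) v ≡ false
fresh-∨C A B v v∉A v∉B = trans (lits-∨C A B v) (cong₂ _∨_ v∉A v∉B)

resolvent-pos : ∀ {n} (A B : Clause n) x →
                (lits (A ∨pos x) ∪ᵛ lits (A ∨C B)) ≗ (⁅ inj₂ x ⁆ᵛ ∪ᵛ lits (A ∨C B))
resolvent-pos A B x v =
  trans (cong₂ _∨_ (lits-∨pos A x v) (lits-∨C A B v))
        (trans (absorbˡ (sameVar (inj₂ x) v) (lits A v) (lits B v))
               (cong (sameVar (inj₂ x) v ∨_) (sym (lits-∨C A B v))))

resolvent-neg : ∀ {n} (A B : Clause n) x →
                (lits (B ∨neg x) ∪ᵛ lits (A ∨C B)) ≗ (⁅ inj₁ x ⁆ᵛ ∪ᵛ lits (A ∨C B))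
resolvent-neg A B x v =
  trans (cong₂ _∨_ (lits-∨neg B x v) (lits-∨C A B v))
        (trans (absorbʳ (sameVar (inj₁ x) v) (lits A v) (lits B v))
               (cong (sameVar (inj₁ x) v ∨_) (sym (lits-∨C A B v))))

weakenClause : ∀ {n prem} (C D : Clause n) (ℓ : Var n) → lits D ℓ ≡ false →
               (lits C ∪ᵛ lits D) ≗ (⁅ ℓ ⁆ᵛ ∪ᵛ lits D) →
               Derivation prem (MC C -P term (setMono (⁅ ℓ ⁆ᵛ ∪ᵛ lits D))) (suc (width D)) (2 * suc (width D))
weakenClause C D ℓ ℓ∉D same =
  adjust (weakening (lits C) (lits D))
         (≡⇒≈P (cong₂ (λ p m → p -P term m) (sym (MC-setMono C)) (setMono-cong same)))
         (ℕP.≤-reflexive size≡) (ℕP.≤-reflexive (cong (2 *_) size≡))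
  where
  size≡ : card (lits C ∪ᵛ lits D) ≡ suc (width D)
  size≡ = trans (card-cong same) (trans (card-insert (lits D) {ℓ} ℓ∉D) (cong suc (card-lits D)))

complementClause : ∀ {n prem} (D : Clause n) (x : Fin n) → lits D (inj₁ x) ≡ false → lits D (inj₂ x) ≡ false →
  Derivation prem (negP (MC D) +P term (setMono (⁅ inj₁ x ⁆ᵛ ∪ᵛ lits D)) +P term (setMono (⁅ inj₂ x ⁆ᵛ ∪ᵛ lits D)))
             (suc (width D)) 3
complementClause D x x∉D x̄∉D =
  adjust (complementation (lits D) x x∉D x̄∉D)
         (≡⇒≈P (cong (λ p → negP p +P term (setMono (⁅ inj₁ x ⁆ᵛ ∪ᵛ lits D)) +P term (setMono (⁅ inj₂ x ⁆ᵛ ∪ᵛ lits D)))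
                     (sym (MC-setMono D))))
         (ℕP.≤-reflexive (cong suc (card-lits D))) ℕP.≤-refl

size-bound : ∀ w → 2 * suc w + 2 * suc w + 3 ≤ 11 * (1 + w * w)
size-bound w = begin
  2 * suc w + 2 * suc w + 3
    ≡⟨ solve 1 (λ w → con 2 :* (con 1 :+ w) :+ con 2 :* (con 1 :+ w) :+ con 3 := con 4 :* w :+ con 7) refl w ⟩
  4 * w + 7
    ≤⟨ ℕP.+-mono-≤ (ℕP.*-monoʳ-≤ 4 (w≤1+w² w)) (ℕP.m≤m*n 7 (1 + w * w)) ⟩
  4 * (1 + w * w) + 7 * (1 + w * w)
    ≡⟨ solve 1 (λ t → con 4 :* t :+ con 7 :* t := con 11 :* t) refl (1 + w * w) ⟩
  11 * (1 + w * w)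
    ∎
  where
  open ℕP.≤-Reasoning
  open +-*-Solver
  w≤1+w² : ∀ w → w ≤ 1 + w * w
  w≤1+w² zero    = z≤n
  w≤1+w² (suc k) = ℕP.m≤n⇒m≤1+n (ℕP.m≤m*n (suc k) (suc k))

lemma4p4 : Σ ℕ λ c → ∀ (n : ℕ) (x : Fin n) (A B : Clause n) →
    x ∉ pos A → x ∉ neg A → x ∉ pos B → x ∉ neg B →
    Σ (SAR n []) λ D →
      Derives D (MC (A ∨pos x) +P MC (B ∨neg x) -P MC (A ∨C B))
      × rank D ≤ width (A ∨C B) + 1
      × size D ≤ c * (1 + width (A ∨C B) * width (A ∨C B))
lemma4p4 = 11 , λ n x A B x∉A⁺ x∉A⁻ x∉B⁺ x∉B⁻ →
  let x∉A∨B  = fresh-∨C A B (inj₁ x) (∉⇒false x∉A⁻) (∉⇒false x∉B⁻)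
      x̄∉A∨B = fresh-∨C A B (inj₂ x) (∉⇒false x∉A⁺) (∉⇒false x∉B⁺)
      left   = weakenClause (A ∨pos x) (A ∨C B) (inj₂ x) x̄∉A∨B (resolvent-pos A B x)
      right  = weakenClause (B ∨neg x) (A ∨C B) (inj₁ x) x∉A∨B (resolvent-neg A B x)
      middle = complementClause (A ∨C B) x x∉A∨B x̄∉A∨B
  in unpack {r = MC (A ∨pos x) +P MC (B ∨neg x) -P MC (A ∨C B)} (adjust (left ⊕ right ⊕ middle)
                    (cut-identity (MC (A ∨pos x)) (MC (B ∨neg x)) (MC (A ∨C B))
                                  (term (setMono (⁅ inj₂ x ⁆ᵛ ∪ᵛ lits (A ∨C B))))
                                  (term (setMono (⁅ inj₁ x ⁆ᵛ ∪ᵛ lits (A ∨C B)))))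
                    (ℕP.≤-reflexive (ℕP.+-comm 1 (width (A ∨C B))))
                    (size-bound (width (A ∨C B))))
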